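{- Let $n\ge 2$ and $\mathbf{w_0}=(s_1 s_2\cdots s_{n-1})(s_1 s_2\cdots s_{n-2})\cdots(s_1 s_2)(s_1)$ in $\mathfrak{S}_n$. For every word $s_{i_1}\cdots s_{i_N}$ in the commutation class of $\mathbf{w_0}$ and every $j$ such that $(i_j,i_{j+1},i_{j+2})$ is of the form $(a,a+1,a)$ or $(a+1,a,a+1)$, one has $(i_j,i_{j+1},i_{j+2})=(1,2,1)$. That is, the only braid moves occurring in words of this commutation class are of the form $s_1s_2s_1$.
   Context: $s_i=(i,i+1)$ are the simple transpositions of $\mathfrak{S}_n$. The commutation class of a reduced word is the set of words obtainable from it by repeatedly replacing an adjacent factor $s_is_j$ with $|i-j|>1$ by $s_js_i$. -}

module Defs where

open import Data.Nat using (ℕ; zero; suc; _+_; _<_)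
open import Data.List using (List; []; _∷_; _++_; map; upTo)
open import Data.Product using (_×_)
open import Data.Sum using (_⊎_)
open import Relation.Binary.PropositionalEquality using (_≡_)
open import Relation.Binary.Construct.Closure.ReflexiveTransitive using (Star)

-- A word s_{i_1} ⋯ s_{i_N} is represented by the list of indices i_1 ∷ ⋯ ∷ i_N.
Word : Set
Word = List ℕ

ascending : ℕ → Word
ascending k = map suc (upTo k)

staircase : ℕ → Word
staircase zero    = []
staircase (suc k) = ascending (suc k) ++ staircase k

-- w_0 = (s_1 ⋯ s_{n-1})(s_1 ⋯ s_{n-2}) ⋯ (s_1) in S_n
w₀ : ℕ → Word
w₀ zero    = []
w₀ (suc m) = staircase m

FarApart : ℕ → ℕ → Set
FarApart i j = (suc i < j) ⊎ (suc j < i)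

data CommStep : Word → Word → Set where
  swap : (u v : Word) (i j : ℕ) → FarApart i j →
         CommStep (u ++ i ∷ j ∷ v) (u ++ j ∷ i ∷ v)

InCommClass : Word → Word → Set
InCommClass w w' = Star CommStep w w'

module Submission where

-- For b ≥ 1 let w|b be the subword of w formed by the letters s_b and
-- s_{b+1}.  A commutation move only swaps letters at distance > 1, so it never
-- swaps two letters of {s_b, s_{b+1}}: the subword w|b is an invariant of the
-- commutation class, and so is the fact that w never uses the letter s_0.
-- In the staircase word w₀ = (s_1 ⋯ s_{n-1}) ⋯ (s_1 s_2)(s_1) every block
-- contributes s_b s_{b+1}, s_b or nothing to w|b, so w|b = (s_b s_{b+1})^r s_b
-- alternates: it never repeats a letter twice in a row.  A factor a(a+1)a with
-- a ≥ 2 would give the repetition (a a) in the subword w|(a-1), and a factor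
-- (a+1)a(a+1) would give the repetition in w|(a+1); a factor 0 1 0 uses s_0.
-- Only 1 2 1 remains.

open import Defs
open import Data.Nat using (ℕ; zero; suc; _+_; _∸_; _≤_; _<_; s≤s; z≤n)
open import Data.Nat.Properties using (_≟_; n≤1+n; ≤-refl; ≤-trans; <⇒≢; >⇒≢; ≤⇒≯; 1+n≢n; m≤n+m; <-≤-connex; m∸n+n≡m)
open import Data.List using ([]; _∷_; _++_; map; filter; upTo)
open import Data.List.Properties using (filter-++; filter-accept; filter-reject; upTo-∷ʳ; map-++)
open import Data.List.Relation.Unary.All as All using (All; []; _∷_)
open import Data.List.Relation.Unary.All.Properties as All using ()
open import Data.List.Relation.Unary.Linked as Linked using (Linked; []; [-]; _∷_)
open import Data.List.Relation.Binary.Permutation.Propositional using (_↭_; ↭-refl; ↭-trans; ↭-swap)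
open import Data.List.Relation.Binary.Permutation.Propositional.Properties using (++⁺ˡ; All-resp-↭)
open import Data.Product using (_×_; _,_)
open import Data.Sum using (_⊎_; inj₁; inj₂)
open import Data.Empty using (⊥-elim)
open import Relation.Nullary using (¬_; Dec; yes; no)
open import Relation.Nullary.Decidable using (_⊎-dec_)
open import Relation.Binary.PropositionalEquality using (_≡_; _≢_; refl; sym; trans; cong; cong₂; subst; ≢-sym; module ≡-Reasoning)
open import Relation.Binary.Construct.Closure.ReflexiveTransitive using (ε; _◅_)

InPair : ℕ → ℕ → Set
InPair b i = (i ≡ b) ⊎ (i ≡ suc b)

inPair? : ∀ b i → Dec (InPair b i)
inPair? b i = (i ≟ b) ⊎-dec (i ≟ suc b)

restrict : ℕ → Word → Word
restrict b = filter (inPair? b)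

below-not-in-pair : ∀ {b i} → i < b → ¬ InPair b i
below-not-in-pair i<b (inj₁ refl) = <⇒≢ i<b refl
below-not-in-pair i<b (inj₂ refl) = <⇒≢ (≤-trans i<b (n≤1+n _)) refl

above-not-in-pair : ∀ {b i} → suc b < i → ¬ InPair b i
above-not-in-pair b+1<i (inj₁ refl) = >⇒≢ (≤-trans (n≤1+n _) b+1<i) refl
above-not-in-pair b+1<i (inj₂ refl) = >⇒≢ b+1<i refl

pair-not-far : ∀ {b i j} → InPair b i → InPair b j → ¬ FarApart i j
pair-not-far ib jb (inj₁ i+1<j) = ≤⇒≯ (near ib jb) i+1<j
  where
  near : ∀ {b i j} → InPair b i → InPair b j → j ≤ suc i
  near (inj₁ refl) (inj₁ refl) = n≤1+n _
  near (inj₁ refl) (inj₂ refl) = ≤-refl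
  near (inj₂ refl) (inj₁ refl) = ≤-trans (n≤1+n _) (n≤1+n _)
  near (inj₂ refl) (inj₂ refl) = n≤1+n _
pair-not-far ib jb (inj₂ j+1<i) = pair-not-far jb ib (inj₁ j+1<i)

-- Subwords on a pair are unchanged by a commutation move: the two swapped
-- letters are far apart, so at most one of them survives in the subword.
restrict-step : ∀ b {w w'} → CommStep w w' → restrict b w ≡ restrict b w'
restrict-step b (swap u v i j far) = begin
  restrict b (u ++ i ∷ j ∷ v)             ≡⟨ filter-++ (inPair? b) u _ ⟩
  restrict b u ++ restrict b (i ∷ j ∷ v)  ≡⟨ cong (restrict b u ++_) swapped ⟩
  restrict b u ++ restrict b (j ∷ i ∷ v)  ≡⟨ sym (filter-++ (inPair? b) u _) ⟩
  restrict b (u ++ j ∷ i ∷ v)             ∎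
  where
  open ≡-Reasoning
  P? = inPair? b
  keep-first : ∀ {i j} → InPair b i → ¬ InPair b j → restrict b (i ∷ j ∷ v) ≡ restrict b (j ∷ i ∷ v)
  keep-first {i} {j} ib ¬jb = begin
    restrict b (i ∷ j ∷ v)  ≡⟨ filter-accept P? ib ⟩
    i ∷ restrict b (j ∷ v)  ≡⟨ cong (i ∷_) (filter-reject P? ¬jb) ⟩
    i ∷ restrict b v        ≡⟨ sym (filter-accept P? ib) ⟩
    restrict b (i ∷ v)      ≡⟨ sym (filter-reject P? ¬jb) ⟩
    restrict b (j ∷ i ∷ v)  ∎
  swapped : restrict b (i ∷ j ∷ v) ≡ restrict b (j ∷ i ∷ v)
  swapped with P? i | P? j
  ... | yes ib  | yes jb  = ⊥-elim (pair-not-far ib jb far)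
  ... | yes ib  | no ¬jb  = keep-first ib ¬jb
  ... | no ¬ib  | yes jb  = sym (keep-first jb ¬ib)
  ... | no ¬ib  | no ¬jb  = begin
    restrict b (i ∷ j ∷ v)  ≡⟨ filter-reject P? ¬ib ⟩
    restrict b (j ∷ v)      ≡⟨ filter-reject P? ¬jb ⟩
    restrict b v            ≡⟨ sym (filter-reject P? ¬ib) ⟩
    restrict b (i ∷ v)      ≡⟨ sym (filter-reject P? ¬jb) ⟩
    restrict b (j ∷ i ∷ v)  ∎

restrict-invariant : ∀ b {w w'} → InCommClass w w' → restrict b w ≡ restrict b w'
restrict-invariant b ε = refl
restrict-invariant b (step ◅ steps) =
  trans (restrict-step b step) (restrict-invariant b steps)

-- Every word of a commutation class is a rearrangement of its representative;
-- this transports the absence of s_0.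
comm⇒↭ : ∀ {w w'} → InCommClass w w' → w ↭ w'
comm⇒↭ ε = ↭-refl
comm⇒↭ (swap u v i j _ ◅ steps) = ↭-trans (++⁺ˡ u (↭-swap i j ↭-refl)) (comm⇒↭ steps)

ascending-snoc : ∀ k → ascending (suc k) ≡ ascending k ++ suc k ∷ []
ascending-snoc k = trans (cong (map suc) (sym (upTo-∷ʳ k))) (map-++ suc (upTo k) (k ∷ []))

restrict-ascending-snoc : ∀ b k →
  restrict b (ascending (suc k)) ≡ restrict b (ascending k) ++ restrict b (suc k ∷ [])
restrict-ascending-snoc b k =
  trans (cong (restrict b) (ascending-snoc k)) (filter-++ (inPair? b) (ascending k) _)

restrict-ascending-below : ∀ {b} k → k < b → restrict b (ascending k) ≡ []
restrict-ascending-below zero _ = refl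
restrict-ascending-below {b} (suc k) k+1<b =
  trans (restrict-ascending-snoc b k)
        (cong₂ _++_ (restrict-ascending-below k (≤-trans (n≤1+n _) k+1<b))
                    (filter-reject (inPair? b) (below-not-in-pair k+1<b)))

restrict-ascending-at : ∀ c → restrict (suc c) (ascending (suc c)) ≡ suc c ∷ []
restrict-ascending-at c =
  trans (restrict-ascending-snoc (suc c) c)
        (cong₂ _++_ (restrict-ascending-below c ≤-refl) (filter-accept (inPair? (suc c)) (inj₁ refl)))

restrict-ascending-above : ∀ c r →
  restrict (suc c) (ascending (suc (r + suc c))) ≡ suc c ∷ suc (suc c) ∷ []
restrict-ascending-above c zero =
  trans (restrict-ascending-snoc (suc c) (suc c))
        (cong₂ _++_ (restrict-ascending-at c) (filter-accept (inPair? (suc c)) (inj₂ refl)))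
restrict-ascending-above c (suc r) =
  trans (restrict-ascending-snoc (suc c) (suc (r + suc c)))
        (cong₂ _++_ (restrict-ascending-above c r)
                    (filter-reject (inPair? (suc c)) (above-not-in-pair (s≤s (s≤s (m≤n+m (suc c) r))))))

zigzag : ℕ → ℕ → Word
zigzag b zero    = b ∷ []
zigzag b (suc r) = b ∷ suc b ∷ zigzag b r

zigzag-alternates : ∀ b r → Linked _≢_ (zigzag b r)
zigzag-alternates b zero          = [-]
zigzag-alternates b (suc zero)    = ≢-sym 1+n≢n ∷ 1+n≢n ∷ [-]
zigzag-alternates b (suc (suc r)) = ≢-sym 1+n≢n ∷ 1+n≢n ∷ zigzag-alternates b (suc r)

restrict-staircase-below : ∀ {b} m → m < b → restrict b (staircase m) ≡ []
restrict-staircase-below zero _ = refl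
restrict-staircase-below {b} (suc m) m+1<b =
  trans (filter-++ (inPair? b) (ascending (suc m)) (staircase m))
        (cong₂ _++_ (restrict-ascending-below (suc m) m+1<b)
                    (restrict-staircase-below m (≤-trans (n≤1+n _) m+1<b)))

restrict-staircase-from : ∀ c r → restrict (suc c) (staircase (r + suc c)) ≡ zigzag (suc c) r
restrict-staircase-from c zero =
  trans (filter-++ (inPair? (suc c)) (ascending (suc c)) (staircase c))
        (cong₂ _++_ (restrict-ascending-at c) (restrict-staircase-below c ≤-refl))
restrict-staircase-from c (suc r) =
  trans (filter-++ (inPair? (suc c)) (ascending (suc (r + suc c))) (staircase (r + suc c)))
        (cong₂ _++_ (restrict-ascending-above c r) (restrict-staircase-from c r))

staircase-alternating : ∀ c m → Linked _≢_ (restrict (suc c) (staircase m))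
staircase-alternating c m with <-≤-connex m (suc c)
... | inj₁ m<b rewrite restrict-staircase-below m m<b = []
... | inj₂ b≤m with m ∸ suc c | m∸n+n≡m b≤m
...   | r | refl rewrite restrict-staircase-from c r = zigzag-alternates (suc c) r

staircase-positive : ∀ m → All (0 <_) (staircase m)
staircase-positive zero    = []
staircase-positive (suc m) =
  All.++⁺ (All.map⁺ (All.universal (λ _ → s≤s z≤n) (upTo (suc m)))) (staircase-positive m)

class-positive : ∀ m {w} → InCommClass (staircase m) w → All (0 <_) w
class-positive m w₀↝w = All-resp-↭ (comm⇒↭ w₀↝w) (staircase-positive m)

class-alternating : ∀ m {w} → InCommClass (staircase m) w → ∀ c → Linked _≢_ (restrict (suc c) w)
class-alternating m w₀↝w c =
  subst (Linked _≢_) (restrict-invariant (suc c) w₀↝w) (staircase-alternating c m)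

linked-suffix : ∀ {A : Set} {R : A → A → Set} xs {ys} → Linked R (xs ++ ys) → Linked R ys
linked-suffix []       linked = linked
linked-suffix (_ ∷ xs) linked = linked-suffix xs (Linked.tail linked)

repeat-in-subword : ∀ b u v {a m} → InPair b a → ¬ InPair b m →
  ¬ Linked _≢_ (restrict b (u ++ a ∷ m ∷ a ∷ v))
repeat-in-subword b u v {a} {m} ab ¬mb alternates =
  Linked.head (linked-suffix (restrict b u) (subst (Linked _≢_) subword alternates)) refl
  where
  open ≡-Reasoning
  P? = inPair? b
  subword : restrict b (u ++ a ∷ m ∷ a ∷ v) ≡ restrict b u ++ a ∷ a ∷ restrict b v
  subword = begin
    restrict b (u ++ a ∷ m ∷ a ∷ v)             ≡⟨ filter-++ P? u _ ⟩
    restrict b u ++ restrict b (a ∷ m ∷ a ∷ v)  ≡⟨ cong (restrict b u ++_) (filter-accept P? ab) ⟩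
    restrict b u ++ a ∷ restrict b (m ∷ a ∷ v)  ≡⟨ cong (λ t → restrict b u ++ a ∷ t) (filter-reject P? ¬mb) ⟩
    restrict b u ++ a ∷ restrict b (a ∷ v)      ≡⟨ cong (λ t → restrict b u ++ a ∷ t) (filter-accept P? ab) ⟩
    restrict b u ++ a ∷ a ∷ restrict b v        ∎

-- The braid factor 0 1 0 uses s_0; a (a+1) a with a ≥ 2 repeats a in the
-- subword on {s_{a-1}, s_a}; (a+1) a (a+1) repeats a+1 in the subword on
-- {s_{a+1}, s_{a+2}}.  Only 1 2 1 survives.
lemma2p2 : (n : ℕ) → 2 ≤ n → (w : Word) → InCommClass (w₀ n) w →
    (u v : Word) (x y z : ℕ) → w ≡ u ++ x ∷ y ∷ z ∷ v →
    ((y ≡ suc x) × (z ≡ x)) ⊎ ((x ≡ suc y) × (z ≡ x)) →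
    (x ≡ 1) × (y ≡ 2) × (z ≡ 1)
lemma2p2 zero () _
lemma2p2 (suc m) _ _ w₀↝w u v zero _ _ refl (inj₁ (refl , refl))
  with All.++⁻ʳ u (class-positive m w₀↝w)
... | () ∷ _
lemma2p2 (suc m) _ _ w₀↝w u v (suc zero) _ _ refl (inj₁ (refl , refl)) = refl , refl , refl
lemma2p2 (suc m) _ _ w₀↝w u v (suc (suc c)) _ _ refl (inj₁ (refl , refl)) =
  ⊥-elim (repeat-in-subword (suc c) u v (inj₂ refl) (above-not-in-pair ≤-refl)
                            (class-alternating m w₀↝w c))
lemma2p2 (suc m) _ _ w₀↝w u v _ y _ refl (inj₂ (refl , refl)) =
  ⊥-elim (repeat-in-subword (suc y) u v (inj₁ refl) (below-not-in-pair ≤-refl)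
                            (class-alternating m w₀↝w y))
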